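{- For every graph $G$ and every non-negative integer $r$, $\nu_r(G)\le \frac12 (2r+2)^{\mathrm{wcol}_{2r}(G)}\,\mathrm{wcol}_{2r}(G)+1$.
   Context: Graphs are finite, simple, non-empty. For a linear order on $V(G)$ given by an injective map $L\colon V(G)\to\mathbb N$, a vertex $u$ is weakly $r$-reachable from $v$ if there is a path of length (number of edges) at most $r$ from $v$ to $u$ such that $L(u)\le L(w)$ for every vertex $w$ of the path (in particular $v$ is weakly $r$-reachable from itself). $\mathrm{WReach}_r[G,L,v]$ is the set of vertices weakly $r$-reachable from $v$, and the weak $r$-colouring number is $\mathrm{wcol}_r(G)=\min_L\max_{v\in V(G)}|\mathrm{WReach}_r[G,L,v]|$ over all linear orders $L$. For a graph $H$, vertex $v$ and integer $r\ge0$, $N_H^r[v]$ is the set of vertices at distance at most $r$ from $v$ in $H$, and $\nu_r(G)=\max_{H\subseteq G,\ \emptyset\ne X\subseteq V(H)} |\{N_H^r[v]\cap X : v\in V(H)\}|/|X|$ over all subgraphs $H$ of $G$ and non-empty $X\subseteq V(H)$. -}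

module Defs where

open import Data.Nat using (ℕ; zero; suc; _+_; _*_; _^_; _≤_)
open import Data.Bool using (Bool; true; false)
open import Data.Fin using (Fin)
open import Data.Fin.Subset using (Subset; _∈_; _⊆_; Nonempty; ∣_∣)
open import Data.List using (List; []; _∷_; length)
open import Data.List.Relation.Unary.All using (All)
open import Data.List.Relation.Unary.AllPairs using (AllPairs)
open import Data.List.Relation.Unary.Unique.Propositional using (Unique)
open import Data.Product using (Σ; Σ-syntax; ∃; ∃-syntax; _×_; _,_)
open import Function.Definitions using (Injective)
open import Relation.Binary.PropositionalEquality using (_≡_)
open import Relation.Nullary using (¬_)

record Graph : Set where
  field
    n        : ℕ
    nonempty : 1 ≤ n
    adj      : Fin n → Fin n → Bool
    adj-sym  : ∀ u v → adj u v ≡ adj v u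
    adj-irr  : ∀ v → adj v v ≡ false
open Graph public

-- Walks, given as the list of visited vertices (from v to u).
-- The length (number of edges) of the walk ws is  length ws - 1.
data Walk {m : ℕ} (E : Fin m → Fin m → Bool) : Fin m → Fin m → List (Fin m) → Set where
  here : ∀ {v} → Walk E v v (v ∷ [])
  step : ∀ {v w u ws} → E v w ≡ true → Walk E w u ws → Walk E v u (v ∷ ws)

Path≤ : {m : ℕ} → (Fin m → Fin m → Bool) → ℕ → Fin m → Fin m → List (Fin m) → Set
Path≤ E r v u ws = Walk E v u ws × Unique ws × length ws ≤ suc r

LinOrder : Graph → Set
LinOrder G = Σ (Fin (n G) → ℕ) (Injective _≡_ _≡_)

WReach : (G : Graph) → ℕ → (Fin (n G) → ℕ) → Fin (n G) → Fin (n G) → Set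
WReach G r L v u = ∃[ ws ] (Path≤ (adj G) r v u ws × All (λ w → L u ≤ L w) ws)

-- Cardinality bounds for a (possibly non-decidable) set P of elements of A.
AtMost : {A : Set} → (A → Set) → ℕ → Set
AtMost {A} P k = (xs : List A) → Unique xs → All P xs → length xs ≤ k

AtLeast : {A : Set} → (A → Set) → ℕ → Set
AtLeast {A} P k = ∃[ xs ] (Unique xs × All P xs × k ≤ length xs)

IsWcol : Graph → ℕ → ℕ → Set
IsWcol G r k =
  (Σ[ L ∈ LinOrder G ] ((v : Fin (n G)) → AtMost (WReach G r (Σ.proj₁ L) v) k))
  × ((L : LinOrder G) → ∃[ v ] AtLeast (WReach G r (Σ.proj₁ L) v) k)

record Subgraph (G : Graph) : Set where
  field
    VH     : Subset (n G)
    EH     : Fin (n G) → Fin (n G) → Bool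
    EH-sym : ∀ u v → EH u v ≡ EH v u
    EH⊆    : ∀ {u v} → EH u v ≡ true → adj G u v ≡ true
    EH-end : ∀ {u v} → EH u v ≡ true → u ∈ VH
open Subgraph public

InBall : {G : Graph} → Subgraph G → ℕ → Fin (n G) → Fin (n G) → Set
InBall H r v x = ∃[ ws ] Path≤ (EH H) r v x ws

SameTrace : {G : Graph} → Subgraph G → ℕ → Subset (n G) → Fin (n G) → Fin (n G) → Set
SameTrace H r X v w = ∀ x → x ∈ X → (InBall H r v x → InBall H r w x) × (InBall H r w x → InBall H r v x)

-- ν_r(G) ≤ a / b  (b > 0): for every subgraph H and non-empty X ⊆ V(H),
-- the number of distinct traces N_H^r[v] ∩ X (v ∈ V(H)) is at most (a/b)|X|,
-- i.e. any list of vertices of H with pairwise distinct traces has length ℓ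
-- with b·ℓ ≤ a·|X|.
ν≤ : Graph → ℕ → ℕ → ℕ → Set
ν≤ G r a b =
  (H : Subgraph G) (X : Subset (n G)) → X ⊆ VH H → Nonempty X →
  (vs : List (Fin (n G))) → All (_∈ VH H) vs →
  AllPairs (λ v w → ¬ SameTrace H r X v w) vs →
  b * length vs ≤ a * ∣ X ∣

-- Fix an order L witnessing wcol_2r(G) ≤ k.  For a vertex v, among the
-- H-walks of length ≤ r from v to a vertex of X, choose one whose L-minimal
-- vertex is as large as possible; let x* be its end.  If x ∈ X lies within
-- distance r of v and m is the L-minimal vertex of a v–x path of length ≤ r,
-- then walking from x* back to v along the chosen walk and on to m shows that
-- m is weakly 2r-reachable from x*.  Hence x ∈ N^r[v] iff some w ∈
-- WReach_2r[x*] has dist(v,w) + dist(w,x) ≤ r, so N^r[v] ∩ X is determined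
-- by the distances from v, truncated at r+1, to the at most k vertices of
-- WReach_2r[x*], of which x* itself is at distance ≤ r.  This leaves at most
-- 1 + |X| (r+1) (r+2)^(k-1) possible traces.

module Submission where

open import Defs
open import Data.Nat using (ℕ; _+_; _*_; _^_)

open import Data.Bool using (Bool; true; false)
open import Data.Fin using (Fin; zero; suc; _≟_)
open import Data.Fin.Subset as Subset using (Subset; ∣_∣)
import Data.Fin.Subset.Properties as Subsetₚ
open import Data.List
  using (List; []; _∷_; [_]; _++_; length; map; zip; reverse; filter; allFin;
         upTo; replicate; concatMap; cartesianProduct; cartesianProductWith)
open import Data.List.Extrema.Nat
  using (argmin; argmax; argmin-sel; argmax-sel; f[argmin]≤f[⊤]; f[argmin]≤f[xs];
         f[⊥]≤f[argmax]; f[xs]≤f[argmax])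
open import Data.List.Membership.Propositional using (_∈_; lose)
open import Data.List.Membership.Propositional.Properties
  using (∈-map⁺; ∈-map⁻; ∈-allFin; ∈-filter⁺; ∈-upTo⁺; ∈-concatMap⁺;
         ∈-cartesianProductWith⁺; ∈-cartesianProduct⁺)
open import Data.List.Properties
  using (length-++; length-map; length-removeAt′; length-reverse; length-upTo; unfold-reverse)
open import Data.List.Relation.Binary.Pointwise using (Pointwise; []; _∷_)
open import Data.List.Relation.Binary.Subset.Propositional using (_⊆_)
open import Data.List.Relation.Unary.All as All using (All; []; _∷_; all?)
open import Data.List.Relation.Unary.All.Properties using (anti-mono; all-filter; ++⁺; ++⁻ˡ; ¬Any⇒All¬)
open import Data.List.Relation.Unary.AllPairs as AllPairs using ([]; _∷_)
import Data.List.Relation.Unary.AllPairs.Properties as AllPairsₚ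
open import Data.List.Relation.Unary.Any using (Any; here; there; index; _─_; any?; satisfied)
open import Data.List.Relation.Unary.Any.Properties using (reverse⁻)
  renaming (map⁺ to Any-map⁺; map⁻ to Any-map⁻)
open import Data.List.Relation.Unary.Unique.Propositional using (Unique)
import Data.List.Relation.Unary.Unique.Propositional.Properties as Unique
open import Data.Nat using (zero; suc; _≤_; _<_; _∸_; z≤n; s≤s; s≤s⁻¹; _≤?_)
open import Data.Nat.Properties hiding (_≟_)
open import Data.Nat.ListAction using (product)
open import Data.Nat.Tactic.RingSolver using (solve-∀)
open import Data.Product using (∃; ∃₂; _×_; _,_; proj₁; proj₂; <_,_>)
open import Data.Sum using (inj₁; inj₂)
open import Data.Vec using ([]; _∷_; here; there)
open import Function using (id; _∘_)
open import Relation.Binary.PropositionalEquality hiding ([_])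
open import Relation.Nullary using (Dec; yes; no; ¬_; ¬?; contradiction)
open import Relation.Nullary.Decidable using (_×-dec_)
open import Relation.Unary using (Decidable)

module _ {A : Set} where

  ∈-─ : ∀ {x y : A} {ys} (x∈ys : x ∈ ys) → y ∈ ys → y ≢ x → y ∈ (ys ─ x∈ys)
  ∈-─ (here refl) (here refl)  y≢x = contradiction refl y≢x
  ∈-─ (here refl) (there y∈ys) _   = y∈ys
  ∈-─ (there _)   (here refl)  _   = here refl
  ∈-─ (there x∈ys) (there y∈ys) y≢x = there (∈-─ x∈ys y∈ys y≢x)

  unique-⊆⇒length≤ : ∀ {xs ys : List A} → Unique xs → xs ⊆ ys → length xs ≤ length ys
  unique-⊆⇒length≤ {[]}     _            _ = z≤n
  unique-⊆⇒length≤ {x ∷ xs} {ys} (x∉xs ∷ xs!) x∷xs⊆ys = begin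
    suc (length xs)           ≤⟨ s≤s (unique-⊆⇒length≤ xs! xs⊆ys─x) ⟩
    suc (length (ys ─ x∈ys))  ≡⟨ length-removeAt′ ys (index x∈ys) ⟨
    length ys                 ∎
    where
    open ≤-Reasoning
    x∈ys = x∷xs⊆ys (here refl)
    xs⊆ys─x : xs ⊆ (ys ─ x∈ys)
    xs⊆ys─x y∈xs = ∈-─ x∈ys (x∷xs⊆ys (there y∈xs)) (≢-sym (All.lookup x∉xs y∈xs))

  module _ (U : List A) (U-complete : ∀ x → x ∈ U) where

    listsUpTo : ℕ → List (List A)
    listsUpTo zero    = [ [] ]
    listsUpTo (suc l) = [] ∷ cartesianProductWith _∷_ U (listsUpTo l)

    ∈-listsUpTo : ∀ {l xs} → length xs ≤ l → xs ∈ listsUpTo l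
    ∈-listsUpTo {zero}  {[]}     _         = here refl
    ∈-listsUpTo {suc l} {[]}     _         = here refl
    ∈-listsUpTo {suc l} {x ∷ xs} (s≤s len) =
      there (∈-cartesianProductWith⁺ _∷_ (U-complete x) (∈-listsUpTo len))

    ∃-short? : ∀ {P : List A → Set} l → Decidable P →
               (∀ {xs} → P xs → length xs ≤ l) → Dec (∃ P)
    ∃-short? l P? short with any? P? (listsUpTo l)
    ... | yes some = yes (satisfied some)
    ... | no none  = no λ (xs , pxs) → none (lose (∈-listsUpTo (short pxs)) pxs)

length-cartesianProductWith : ∀ {A B C : Set} (f : A → B → C) xs ys →
  length (cartesianProductWith f xs ys) ≡ length xs * length ys
length-cartesianProductWith f []       ys = refl
length-cartesianProductWith f (x ∷ xs) ys = begin
  length (map (f x) ys ++ cartesianProductWith f xs ys)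
    ≡⟨ length-++ (map (f x) ys) ⟩
  length (map (f x) ys) + length (cartesianProductWith f xs ys)
    ≡⟨ cong₂ _+_ (length-map (f x) ys) (length-cartesianProductWith f xs ys) ⟩
  length ys + length xs * length ys
    ∎
  where open ≡-Reasoning

length-concatMap≤ : ∀ {A B : Set} {f : A → List B} {b} → (∀ x → length (f x) ≤ b) →
  ∀ xs → length (concatMap f xs) ≤ length xs * b
length-concatMap≤ _ [] = z≤n
length-concatMap≤ {f = f} {b} bound (x ∷ xs) = begin
  length (f x ++ concatMap f xs)         ≡⟨ length-++ (f x) ⟩
  length (f x) + length (concatMap f xs) ≤⟨ +-mono-≤ (bound x) (length-concatMap≤ bound xs) ⟩
  b + length xs * b                      ∎
  where open ≤-Reasoning

zip-map-self : ∀ {A B : Set} (f : A → B) xs → zip xs (map f xs) ≡ map < id , f > xs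
zip-map-self f []       = refl
zip-map-self f (x ∷ xs) = cong ((x , f x) ∷_) (zip-map-self f xs)

boundedLists : List ℕ → List (List ℕ)
boundedLists []       = [ [] ]
boundedLists (b ∷ bs) = cartesianProductWith _∷_ (upTo b) (boundedLists bs)

length-boundedLists : ∀ bs → length (boundedLists bs) ≡ product bs
length-boundedLists []       = refl
length-boundedLists (b ∷ bs) = trans (length-cartesianProductWith _∷_ (upTo b) (boundedLists bs))
  (cong₂ _*_ (length-upTo b) (length-boundedLists bs))

∈-boundedLists : ∀ {ds bs} → Pointwise _<_ ds bs → ds ∈ boundedLists bs
∈-boundedLists []           = here refl
∈-boundedLists (d<b ∷ ds<bs) = ∈-cartesianProductWith⁺ _∷_ (∈-upTo⁺ d<b) (∈-boundedLists ds<bs)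

Pointwise-map-replicate : ∀ {A : Set} {f : A → ℕ} {b} → (∀ x → f x < b) →
  ∀ xs → Pointwise _<_ (map f xs) (replicate (length xs) b)
Pointwise-map-replicate f<b []       = []
Pointwise-map-replicate f<b (x ∷ xs) = f<b x ∷ Pointwise-map-replicate f<b xs

product-replicate : ∀ m b → product (replicate m b) ≡ b ^ m
product-replicate zero    b = refl
product-replicate (suc m) b = cong (b *_) (product-replicate m b)

module _ {A : Set} (f : A → ℕ) where

  argmin-∈ : ∀ x xs → argmin f x xs ∈ x ∷ xs
  argmin-∈ x xs with argmin-sel f x xs
  ... | inj₁ ≡x   = here ≡x
  ... | inj₂ ∈xs  = there ∈xs

  argmin-minimal : ∀ {x xs y} → y ∈ x ∷ xs → f (argmin f x xs) ≤ f y
  argmin-minimal {x} {xs} (here refl) = f[argmin]≤f[⊤] {f = f} x xs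
  argmin-minimal {x} {xs} (there y∈xs) = All.lookup (f[argmin]≤f[xs] {f = f} x xs) y∈xs

  argmax-∈ : ∀ x xs → argmax f x xs ∈ x ∷ xs
  argmax-∈ x xs with argmax-sel f x xs
  ... | inj₁ ≡x   = here ≡x
  ... | inj₂ ∈xs  = there ∈xs

  argmax-maximal : ∀ {x xs y} → y ∈ x ∷ xs → f y ≤ f (argmax f x xs)
  argmax-maximal {x} {xs} (here refl) = f[⊥]≤f[argmax] {f = f} x xs
  argmax-maximal {x} {xs} (there y∈xs) = All.lookup (f[xs]≤f[argmax] {f = f} x xs) y∈xs

elements : ∀ {m} → Subset m → List (Fin m)
elements []            = []
elements (true  ∷ p)   = zero ∷ map suc (elements p)
elements (false ∷ p)   = map suc (elements p)

length-elements : ∀ {m} (p : Subset m) → length (elements p) ≡ ∣ p ∣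
length-elements []          = refl
length-elements (true  ∷ p) = cong suc (trans (length-map suc (elements p)) (length-elements p))
length-elements (false ∷ p) = trans (length-map suc (elements p)) (length-elements p)

∈-elements : ∀ {m} {x : Fin m} {p} → x Subset.∈ p → x ∈ elements p
∈-elements {p = true  ∷ p} here         = here refl
∈-elements {p = true  ∷ p} (there x∈p)  = there (∈-map⁺ suc (∈-elements x∈p))
∈-elements {p = false ∷ p} (there x∈p)  = ∈-map⁺ suc (∈-elements x∈p)

-- Returns l when no i < l satisfies P.
least : {P : ℕ → Set} → Decidable P → ℕ → ℕ
least P? zero    = zero
least P? (suc l) with P? zero
... | yes _ = zero
... | no  _ = suc (least (P? ∘ suc) l)

least≤ : ∀ {P} (P? : Decidable P) l → least P? l ≤ l
least≤ P? zero    = z≤n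
least≤ P? (suc l) with P? zero
... | yes _ = z≤n
... | no  _ = s≤s (least≤ (P? ∘ suc) l)

least-satisfies : ∀ {P} (P? : Decidable P) l → least P? l < l → P (least P? l)
least-satisfies P? (suc l) lt with P? zero
... | yes p0 = p0
... | no  _  = least-satisfies (P? ∘ suc) l (s≤s⁻¹ lt)

least-minimal : ∀ {P} (P? : Decidable P) l {i} → P i → least P? l ≤ i
least-minimal P? zero    _ = z≤n
least-minimal P? (suc l) {zero} p0 with P? zero
... | yes _   = z≤n
... | no  ¬p0 = contradiction p0 ¬p0
least-minimal P? (suc l) {suc i} pi with P? zero
... | yes _ = z≤n
... | no  _ = s≤s (least-minimal (P? ∘ suc) l pi)

mapʷ : ∀ {m} {E E′ : Fin m → Fin m → Bool} → (∀ {a b} → E a b ≡ true → E′ a b ≡ true) →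
  ∀ {v u ws} → Walk E v u ws → Walk E′ v u ws
mapʷ E⊆E′ here       = here
mapʷ E⊆E′ (step e p) = step (E⊆E′ e) (mapʷ E⊆E′ p)

module _ {m : ℕ} {E : Fin m → Fin m → Bool} where

  open import Data.List.Membership.DecPropositional (_≟_ {m}) using (_∈?_)

  walk-start : ∀ {v u ws} → Walk E v u ws → ∃ λ t → ws ≡ v ∷ t
  walk-start here       = [] , refl
  walk-start (step _ _) = _ , refl

  walk-source : ∀ {v u w ws} → Walk E v u (w ∷ ws) → v ≡ w
  walk-source here       = refl
  walk-source (step _ _) = refl

  infixr 5 _++ʷ_
  _++ʷ_ : ∀ {v u w ws zs} → Walk E v u ws → Walk E u w (u ∷ zs) → Walk E v w (ws ++ zs)
  here     ++ʷ q = q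
  step e p ++ʷ q = step e (p ++ʷ q)

  reverseʷ : (∀ a b → E a b ≡ E b a) → ∀ {v u ws} → Walk E v u ws → Walk E u v (reverse ws)
  reverseʷ E-sym here = here
  reverseʷ E-sym {v} (step {w = w} {ws = ws} e p) =
    subst (Walk E _ v) (sym (unfold-reverse v ws)) (reverseʷ E-sym p ++ʷ step (trans (E-sym w v) e) here)

  splitAt : ∀ {v u m t} → Walk E v u (v ∷ t) → m ∈ v ∷ t →
            ∃₂ λ t₁ t₂ → Walk E v m (v ∷ t₁) × Walk E m u (m ∷ t₂) × t ≡ t₁ ++ t₂
  splitAt p (here refl) = [] , _ , here , p , refl
  splitAt here (there ())
  splitAt (step e p) (there m∈t) with walk-start p
  ... | _ , refl with splitAt p m∈t
  ...   | t₁ , t₂ , p₁ , p₂ , refl = _ ∷ t₁ , t₂ , step e p₁ , p₂ , refl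

  suffixFrom : ∀ {w u v ps} → Walk E w u ps → Unique ps → v ∈ ps →
               ∃ λ qs → Walk E v u qs × Unique qs × qs ⊆ ps
  suffixFrom here       ps! (here refl) = _ , here , ps! , id
  suffixFrom (step e p) ps! (here refl) = _ , step e p , ps! , id
  suffixFrom here       _   (there ())
  suffixFrom (step _ p) (_ ∷ ps!) (there v∈ps) with suffixFrom p ps! v∈ps
  ... | qs , q , qs! , qs⊆ps = qs , q , qs! , there ∘ qs⊆ps

  toPath : ∀ {v u ws} → Walk E v u ws → ∃ λ ps → Walk E v u ps × Unique ps × ps ⊆ ws
  toPath here = _ , here , [] ∷ [] , id
  toPath {v} (step e p) with toPath p
  ... | ps , q , ps! , ps⊆ws with v ∈? ps
  ...   | yes v∈ps = let qs , q′ , qs! , qs⊆ps = suffixFrom q ps! v∈ps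
                     in qs , q′ , qs! , there ∘ ps⊆ws ∘ qs⊆ps
  ...   | no  v∉ps = v ∷ ps , step e q , ¬Any⇒All¬ ps v∉ps ∷ ps! ,
                     λ { (here refl) → here refl ; (there y∈ps) → there (ps⊆ws y∈ps) }

  walkFrom? : ∀ v u ws → Dec (Walk E v u (v ∷ ws))
  walkFrom? v u [] with v ≟ u
  ... | yes refl = yes here
  ... | no  v≢u  = no λ { here → v≢u refl }
  walkFrom? v u (w ∷ ws) with E v w in vw | walkFrom? w u ws
  ... | true  | yes p = yes (step vw p)
  ... | true  | no ¬p = no λ { (step _ p) → ¬p (subst (λ s → Walk E s u (w ∷ ws)) (walk-source p) p) }
  ... | false | _     = no λ { (step e p) →
    contradiction (trans (sym vw) (subst (λ s → E v s ≡ true) (walk-source p) e)) λ () }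

  walk? : ∀ v u ws → Dec (Walk E v u ws)
  walk? v u []       = no λ ()
  walk? v u (w ∷ ws) with v ≟ w
  ... | yes refl = walkFrom? v u ws
  ... | no  v≢w  = no (v≢w ∘ walk-source)

module Profiles (G : Graph) (r : ℕ) (L : Fin (n G) → ℕ) (H : Subgraph G) (X : Subset (n G)) where

  private
    V : Set
    V = Fin (n G)

    vertices : List V
    vertices = allFin (n G)

    shortLists : ℕ → List (List V)
    shortLists = listsUpTo vertices ∈-allFin

  -- Walks rather than paths, so that they can be concatenated.
  Reach : ℕ → V → V → Set
  Reach j v w = ∃ λ ws → Walk (EH H) v w ws × length ws ≤ suc j

  reach? : ∀ j v w → Dec (Reach j v w)
  reach? j v w = ∃-short? vertices ∈-allFin (suc j) (λ ws → walk? v w ws ×-dec length ws ≤? suc j) proj₂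

  Reach-mono : ∀ {i j v w} → i ≤ j → Reach i v w → Reach j v w
  Reach-mono i≤j (ws , p , len) = ws , p , ≤-trans len (s≤s i≤j)

  Reach-trans : ∀ {i j u v w} → Reach i u v → Reach j v w → Reach (i + j) u w
  Reach-trans {i} {j} (ws , p , len₁) (zs , q , len₂) with walk-start q
  ... | zs′ , refl = ws ++ zs′ , p ++ʷ q ,
    subst (_≤ suc (i + j)) (sym (length-++ ws)) (+-mono-≤ len₁ (s≤s⁻¹ len₂))

  InBall⇒Reach : ∀ {j v x} → InBall H j v x → Reach j v x
  InBall⇒Reach (ws , p , _ , len) = ws , p , len

  Reach⇒InBall : ∀ {j v x} → Reach j v x → InBall H j v x
  Reach⇒InBall (ws , p , len) with toPath p
  ... | ps , q , ps! , ps⊆ws = ps , q , ps! , ≤-trans (unique-⊆⇒length≤ ps! ps⊆ws) len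

  -- Distance in H, truncated: the value r + 1 stands for "more than r".
  dist : V → V → ℕ
  dist v w = least (λ j → reach? j v w) (suc r)

  dist≤1+r : ∀ v w → dist v w ≤ suc r
  dist≤1+r v w = least≤ (λ j → reach? j v w) (suc r)

  dist-reach : ∀ {v w} → dist v w ≤ r → Reach (dist v w) v w
  dist-reach {v} {w} d≤r = least-satisfies (λ j → reach? j v w) (suc r) (s≤s d≤r)

  dist-minimal : ∀ {j v w} → Reach j v w → dist v w ≤ j
  dist-minimal {v = v} {w} = least-minimal (λ j → reach? j v w) (suc r)

  WeakWalk : V → V → Set
  WeakWalk x w = ∃ λ ws → Walk (adj G) x w ws × length ws ≤ suc (2 * r) × All (λ y → L w ≤ L y) ws

  weakWalk? : ∀ x w → Dec (WeakWalk x w)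
  weakWalk? x w = ∃-short? vertices ∈-allFin (suc (2 * r))
    (λ ws → walk? x w ws ×-dec (length ws ≤? suc (2 * r) ×-dec all? (λ y → L w ≤? L y) ws))
    (proj₁ ∘ proj₂)

  WeakWalk⇒WReach : ∀ {x w} → WeakWalk x w → WReach G (2 * r) L x w
  WeakWalk⇒WReach (ws , p , len , low) with toPath p
  ... | ps , q , ps! , ps⊆ws =
    ps , (q , ps! , ≤-trans (unique-⊆⇒length≤ ps! ps⊆ws) len) , anti-mono ps⊆ws low

  WReach≤ : ℕ → Set
  WReach≤ k = ∀ v → AtMost (WReach G (2 * r) L v) k

  IsOther : V → V → Set
  IsOther x w = w ≢ x × WeakWalk x w

  isOther? : ∀ x → Decidable (IsOther x)
  isOther? x w = ¬? (w ≟ x) ×-dec weakWalk? x w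

  others : V → List V
  others x = filter (isOther? x) vertices

  wreach : V → List V
  wreach x = x ∷ others x

  ∈-wreach : ∀ {x w} → WeakWalk x w → w ∈ wreach x
  ∈-wreach {x} {w} xw with w ≟ x
  ... | yes refl = here refl
  ... | no  w≢x  = there (∈-filter⁺ (isOther? x) (∈-allFin w) (w≢x , xw))

  length-wreach≤ : ∀ {k} → WReach≤ k → ∀ x → length (wreach x) ≤ k
  length-wreach≤ wcol≤k x =
    wcol≤k x (wreach x) (x∉others ∷ others!)
      (WeakWalk⇒WReach x↝x ∷ All.map (WeakWalk⇒WReach ∘ proj₂) others-sound)
    where
    others-sound : All (IsOther x) (others x)
    others-sound = all-filter (isOther? x) vertices
    x∉others = All.map (λ (w≢x , _) → w≢x ∘ sym) others-sound
    others! = Unique.filter⁺ (isOther? x) (Unique.allFin⁺ (n G))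
    x↝x : WeakWalk x x
    x↝x = [ x ] , here , s≤s z≤n , ≤-refl ∷ []

  Candidate : V → V × List V → Set
  Candidate v (x , ws) = x Subset.∈ X × Walk (EH H) v x ws × length ws ≤ suc r

  candidate? : ∀ v → Decidable (Candidate v)
  candidate? v (x , ws) = x Subsetₚ.∈? X ×-dec (walk? v x ws ×-dec length ws ≤? suc r)

  candidates : V → List (V × List V)
  candidates v = filter (candidate? v) (cartesianProduct vertices (shortLists (suc r)))

  ∈-candidates : ∀ {v c} → Candidate v c → c ∈ candidates v
  ∈-candidates {v} {x , ws} c@(_ , _ , len) =
    ∈-filter⁺ (candidate? v) (∈-cartesianProduct⁺ (∈-allFin x) (∈-listsUpTo vertices ∈-allFin len)) c

  candidates-sound : ∀ {v c} → c ∈ candidates v → Candidate v c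
  candidates-sound {v} = All.lookup (all-filter (candidate? v) (cartesianProduct vertices (shortLists (suc r))))

  -- 0 on [], which is not a walk.
  bottleneck : List V → ℕ
  bottleneck []       = 0
  bottleneck (w ∷ ws) = L (argmin L w ws)

  bottleneck-minimal : ∀ {ws y} → y ∈ ws → bottleneck ws ≤ L y
  bottleneck-minimal {_ ∷ _} = argmin-minimal L

  best : V × List V → List (V × List V) → V × List V
  best = argmax (bottleneck ∘ proj₂)

  profileAt : V → V → List (V × ℕ)
  profileAt v x = map < id , dist v > (wreach x)

  profile : V → List (V × ℕ)
  profile v with candidates v
  ... | []     = []
  ... | c ∷ cs = profileAt v (proj₁ (best c cs))

  Decodes : List (V × ℕ) → V → Set
  Decodes ps x = Any (λ (w , d) → ∃ λ e → d + e ≤ r × InBall H e w x) ps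

  profileAt⇒InBall : ∀ {v x* x} → Decodes (profileAt v x*) x → InBall H r v x
  profileAt⇒InBall decodes with satisfied (Any-map⁻ decodes)
  ... | w , e , d+e≤r , ball =
    Reach⇒InBall (Reach-mono d+e≤r (Reach-trans (dist-reach (m+n≤o⇒m≤o _ d+e≤r)) (InBall⇒Reach ball)))

  weakWalk-via-start : ∀ {v x* ws* m t} → Walk (EH H) v x* ws* → length ws* ≤ suc r →
    All (λ y → L m ≤ L y) ws* → Walk (EH H) v m (v ∷ t) → length t ≤ r → All (λ y → L m ≤ L y) t →
    WeakWalk x* m
  weakWalk-via-start {ws* = ws*} {t = t} p* len* low* p len low =
    reverse ws* ++ t , mapʷ (EH⊆ H) (reverseʷ (EH-sym H) p* ++ʷ p) , length≤ ,
    ++⁺ (anti-mono reverse⁻ low*) low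
    where
    open ≤-Reasoning
    length≤ : length (reverse ws* ++ t) ≤ suc (2 * r)
    length≤ = begin
      length (reverse ws* ++ t)        ≡⟨ length-++ (reverse ws*) ⟩
      length (reverse ws*) + length t  ≡⟨ cong (_+ length t) (length-reverse ws*) ⟩
      length ws* + length t            ≤⟨ +-mono-≤ len* len ⟩
      suc r + r                        ≡⟨ cong (λ z → suc (r + z)) (+-identityʳ r) ⟨
      suc (2 * r)                      ∎

  InBall⇒profileAt : ∀ {v x* ws* x} → Candidate v (x* , ws*) →
    (∀ {c} → Candidate v c → bottleneck (proj₂ c) ≤ bottleneck ws*) →
    x Subset.∈ X → InBall H r v x → Decodes (profileAt v x*) x
  InBall⇒profileAt {v} {x*} {ws*} (_ , p* , len*) maximal x∈X (ws , p , _ , len) with walk-start p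
  ... | t , refl with splitAt p (argmin-∈ L v t)
  ... | t₁ , t₂ , p₁ , p₂ , refl =
    Any-map⁺ (lose (∈-wreach m-reachable) (length t₂ , d+e≤r , Reach⇒InBall (_ , p₂ , ≤-refl)))
    where
    m = argmin L v (t₁ ++ t₂)
    t₁+t₂≤r : length t₁ + length t₂ ≤ r
    t₁+t₂≤r = subst (_≤ r) (length-++ t₁) (s≤s⁻¹ len)
    d+e≤r : dist v m + length t₂ ≤ r
    d+e≤r = ≤-trans (+-monoˡ-≤ (length t₂) (dist-minimal (_ , p₁ , ≤-refl))) t₁+t₂≤r
    m-low : All (λ y → L m ≤ L y) (v ∷ t₁ ++ t₂)
    m-low = All.tabulate (argmin-minimal L)
    m-low* : All (λ y → L m ≤ L y) ws*
    m-low* = All.tabulate (≤-trans (maximal (x∈X , p , len)) ∘ bottleneck-minimal)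
    m-reachable : WeakWalk x* m
    m-reachable = weakWalk-via-start p* len* m-low* p₁ (m+n≤o⇒m≤o _ t₁+t₂≤r) (++⁻ˡ t₁ (All.tail m-low))

  best-candidate : ∀ {v c cs} → candidates v ≡ c ∷ cs → Candidate v (best c cs)
  best-candidate {c = c} {cs} eq =
    candidates-sound (subst (_ ∈_) (sym eq) (argmax-∈ (bottleneck ∘ proj₂) c cs))

  best-maximal : ∀ {v c cs} → candidates v ≡ c ∷ cs →
    ∀ {c′} → Candidate v c′ → bottleneck (proj₂ c′) ≤ bottleneck (proj₂ (best c cs))
  best-maximal eq c′ = argmax-maximal (bottleneck ∘ proj₂) (subst (_ ∈_) eq (∈-candidates c′))

  InBall⇒Decodes : ∀ {v x} → x Subset.∈ X → InBall H r v x → Decodes (profile v) x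
  InBall⇒Decodes {v} x∈X ball@(ws , p , _ , len) with candidates v in eq
  ... | []     = contradiction (subst (_ ∈_) eq (∈-candidates (x∈X , p , len))) λ ()
  ... | _ ∷ _  = InBall⇒profileAt (best-candidate eq) (best-maximal eq) x∈X ball

  Decodes⇒InBall : ∀ {v x} → Decodes (profile v) x → InBall H r v x
  Decodes⇒InBall {v} with candidates v
  ... | []     = λ ()
  ... | _ ∷ _  = profileAt⇒InBall

  profile-≡⇒SameTrace : ∀ {v w} → profile v ≡ profile w → SameTrace H r X v w
  profile-≡⇒SameTrace eq x x∈X = transport eq , transport (sym eq)
    where
    transport : ∀ {a b} → profile a ≡ profile b → InBall H r a x → InBall H r b x
    transport e = Decodes⇒InBall ∘ subst (λ ps → Decodes ps x) e ∘ InBall⇒Decodes x∈X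

  bounds : V → List ℕ
  bounds x = suc r ∷ replicate (length (others x)) (suc (suc r))

  profilesAt : V → List (List (V × ℕ))
  profilesAt x = map (zip (wreach x)) (boundedLists (bounds x))

  profiles : List (List (V × ℕ))
  profiles = [] ∷ concatMap profilesAt (elements X)

  profile∈profiles : ∀ v → profile v ∈ profiles
  profile∈profiles v with candidates v in eq
  ... | []     = here refl
  ... | c ∷ cs with best-candidate eq
  ...   | x*∈X , p* , len* = there (∈-concatMap⁺ profilesAt (lose (∈-elements x*∈X) profile∈profilesAt))
    where
    x* = proj₁ (best c cs)
    dists-bounded : Pointwise _<_ (map (dist v) (wreach x*)) (bounds x*)
    dists-bounded =
      s≤s (dist-minimal (_ , p* , len*)) ∷ Pointwise-map-replicate (s≤s ∘ dist≤1+r v) (others x*)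
    profile∈profilesAt : profileAt v x* ∈ profilesAt x*
    profile∈profilesAt = subst (_∈ profilesAt x*) (zip-map-self (dist v) (wreach x*))
      (∈-map⁺ (zip (wreach x*)) (∈-boundedLists dists-bounded))

  length-profilesAt : ∀ {k} → WReach≤ k → ∀ x → length (profilesAt x) ≤ suc r * suc (suc r) ^ (k ∸ 1)
  length-profilesAt {k} wcol≤k x = begin
    length (profilesAt x)                      ≡⟨ length-map _ (boundedLists (bounds x)) ⟩
    length (boundedLists (bounds x))           ≡⟨ length-boundedLists (bounds x) ⟩
    suc r * product (replicate (length (others x)) (suc (suc r)))
      ≡⟨ cong (suc r *_) (product-replicate (length (others x)) (suc (suc r))) ⟩
    suc r * suc (suc r) ^ length (others x)
      ≤⟨ *-monoʳ-≤ (suc r) (^-monoʳ-≤ (suc (suc r)) (∸-monoˡ-≤ 1 (length-wreach≤ wcol≤k x))) ⟩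
    suc r * suc (suc r) ^ (k ∸ 1)              ∎
    where open ≤-Reasoning

  length-profiles : ∀ {k} → WReach≤ k →
    length profiles ≤ suc (∣ X ∣ * (suc r * suc (suc r) ^ (k ∸ 1)))
  length-profiles wcol≤k = s≤s (begin
    length (concatMap profilesAt (elements X))
      ≤⟨ length-concatMap≤ (length-profilesAt wcol≤k) (elements X) ⟩
    length (elements X) * _                     ≡⟨ cong (_* _) (length-elements X) ⟩
    ∣ X ∣ * _                                   ∎)
    where open ≤-Reasoning

  distinct-traces⇒length≤ : ∀ {vs} → AllPairs.AllPairs (λ v w → ¬ SameTrace H r X v w) vs →
    length vs ≤ length profiles
  distinct-traces⇒length≤ {vs} distinct = begin
    length vs                ≡⟨ length-map profile vs ⟨
    length (map profile vs)  ≤⟨ unique-⊆⇒length≤ profiles! profiles⊆ ⟩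
    length profiles          ∎
    where
    open ≤-Reasoning
    profiles! : Unique (map profile vs)
    profiles! = AllPairsₚ.map⁺ (AllPairs.map (_∘ profile-≡⇒SameTrace) distinct)
    profiles⊆ : map profile vs ⊆ profiles
    profiles⊆ ps∈ with ∈-map⁻ profile ps∈
    ... | v , _ , refl = profile∈profiles v

twice-profile-count≤ : ∀ r k → 1 ≤ k → 2 * (suc r * suc (suc r) ^ (k ∸ 1)) ≤ (2 * r + 2) ^ k * k
twice-profile-count≤ r (suc k) _ = begin
  2 * (suc r * suc (suc r) ^ k)     ≡⟨ twice-suc r (suc (suc r) ^ k) ⟩
  (2 * r + 2) * suc (suc r) ^ k     ≤⟨ *-monoʳ-≤ (2 * r + 2) (^-monoˡ-≤ k r+2≤2r+2) ⟩
  (2 * r + 2) ^ suc k               ≤⟨ m≤m*n _ (suc k) ⟩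
  (2 * r + 2) ^ suc k * suc k       ∎
  where
  open ≤-Reasoning
  twice-suc : ∀ r p → 2 * (suc r * p) ≡ (2 * r + 2) * p
  twice-suc = solve-∀
  r+2≤2r+2 : suc (suc r) ≤ 2 * r + 2
  r+2≤2r+2 = ≤-trans (≤-reflexive (+-comm 2 r)) (+-monoˡ-≤ 2 (m≤n*m r 2))

count-arithmetic : ∀ {ℓ x b q} → ℓ ≤ suc (x * b) → 1 ≤ x → 2 * b ≤ q → 2 * ℓ ≤ (q + 2) * x
count-arithmetic {ℓ} {x} {b} {q} ℓ≤ 1≤x 2b≤q = begin
  2 * ℓ              ≤⟨ *-monoʳ-≤ 2 ℓ≤ ⟩
  2 * suc (x * b)    ≡⟨ twice-suc-* x b ⟩
  2 + x * (2 * b)    ≤⟨ +-mono-≤ (*-monoʳ-≤ 2 1≤x) (*-monoʳ-≤ x 2b≤q) ⟩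
  2 * x + x * q      ≡⟨ twice-+-* x q ⟩
  (q + 2) * x        ∎
  where
  open ≤-Reasoning
  twice-suc-* : ∀ x b → 2 * suc (x * b) ≡ 2 + x * (2 * b)
  twice-suc-* = solve-∀
  twice-+-* : ∀ x q → 2 * x + x * q ≡ (q + 2) * x
  twice-+-* = solve-∀

∈⇒1≤length : ∀ {A : Set} {x : A} {xs} → x ∈ xs → 1 ≤ length xs
∈⇒1≤length {xs = _ ∷ _} _ = s≤s z≤n

theorem3 : (G : Graph) (r k : ℕ) → IsWcol G (2 * r) k →
    ν≤ G r ((2 * r + 2) ^ k * k + 2) 2
theorem3 G r k (((L , _) , wcol≤k) , _) H X _ (x₀ , x₀∈X) vs _ distinct =
  count-arithmetic
    (≤-trans (distinct-traces⇒length≤ distinct) (length-profiles wcol≤k))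
    (subst (1 ≤_) (length-elements X) (∈⇒1≤length (∈-elements x₀∈X)))
    (twice-profile-count≤ r k (≤-trans (s≤s z≤n) (length-wreach≤ wcol≤k x₀)))
  where open Profiles G r L H X
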